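{- Let $G$ be an equatorial graph with girth $g$ and equator $q$, let $k=\lceil g/2\rceil-1$, let $C=u_0,\dots,u_{q-1}$ be an isometric cycle of length $q$ in $G$, let $e_i=u_iu_{i+1}$, and let $L_i=\mathcal{D}_k(u_{i-k})\cap\mathcal{D}_k(u_{i+k})$ for $i\in\{0,\dots,q-1\}$ (all indices mod $q$). Then for every $i$: if $g$ is odd, $\mathcal{D}_k(u_i)=L_{i-k}\cup\dots\cup L_{i+k}$; if $g$ is even, $\mathcal{D}_k(e_i)=L_{i-k}\cup\dots\cup L_{i+k+1}$.
   Context: For a vertex $u$, $\mathcal{D}_i(u)=\{v: d(u,v)\le i\}$; for an edge $e=uv$, $\mathcal{D}_i(e)=\mathcal{D}_i(u)\cup\mathcal{D}_i(v)$. A cycle $C$ is isometric if $d_C(x,y)=d_G(x,y)$ for all $x,y\in V(C)$; the equator is the length of a longest isometric cycle. For $\delta\ge2$, $g\ge3$, $k=\lceil g/2\rceil-1$, the Moore bound is $M(\delta,g)=1+\sum_{i=0}^{k-1}\delta(\delta-1)^i$ for odd $g$ and $M(\delta,g)=2+\sum_{i=1}^{k}2(\delta-1)^i$ for even $g$. An equatorial graph is a finite graph with girth $g$, minimum degree $\delta$ and equator $q>6k+3$ whose order is exactly $\frac{q}{g}M(\delta,g)$. -}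

module Defs where

open import Data.Nat using (ℕ; zero; suc; _+_; _*_; _∸_; _^_; _≤_; _<_; _⊓_; ∣_-_∣; NonZero; _/_; _%_)
open import Data.Nat.DivMod using (_mod_)
open import Data.Fin using (Fin; toℕ)
open import Data.Bool using (Bool; true; false; T)
open import Data.List using (List; length; filterᵇ; allFin)
open import Data.Product using (Σ; ∃; _×_; _,_)
open import Data.Sum using (_⊎_)
open import Relation.Binary.PropositionalEquality using (_≡_)

record Graph (n : ℕ) : Set where
  field
    adj    : Fin n → Fin n → Bool
    sym    : ∀ u v → adj u v ≡ adj v u
    irrefl : ∀ u → adj u u ≡ false
open Graph public

module _ {n : ℕ} (G : Graph n) where

  data Walk : Fin n → Fin n → ℕ → Set where
    nil  : ∀ {u} → Walk u u 0
    cons : ∀ {u w v ℓ} → T (adj G u w) → Walk w v ℓ → Walk u v (suc ℓ)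

  IsDist : Fin n → Fin n → ℕ → Set
  IsDist u v d = Walk u v d × (∀ ℓ → Walk u v ℓ → d ≤ ℓ)

  Ball : ℕ → Fin n → Fin n → Set
  Ball i u v = ∃ λ ℓ → ℓ ≤ i × Walk u v ℓ

  EdgeBall : ℕ → Fin n → Fin n → Fin n → Set
  EdgeBall i u w v = Ball i u v ⊎ Ball i w v

  degree : Fin n → ℕ
  degree v = length (filterᵇ (adj G v) (allFin n))

  MinDegree : ℕ → Set
  MinDegree δ = (∀ v → δ ≤ degree v) × (∃ λ v → degree v ≡ δ)

  IsCycle : (m : ℕ) → (Fin m → Fin n) → Set
  IsCycle m c =
    (3 ≤ m)
    × (∀ x y → c x ≡ c y → x ≡ y)
    × (∀ x y → (suc (toℕ x) ≡ toℕ y ⊎ (suc (toℕ x) ≡ m × toℕ y ≡ 0))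
             → T (adj G (c x) (c y)))

  cycDist : ℕ → ℕ → ℕ → ℕ
  cycDist m x y = ∣ x - y ∣ ⊓ (m ∸ ∣ x - y ∣)

  IsIsometricCycle : (m : ℕ) → (Fin m → Fin n) → Set
  IsIsometricCycle m c =
    IsCycle m c × (∀ x y → IsDist (c x) (c y) (cycDist m (toℕ x) (toℕ y)))

  Girth : ℕ → Set
  Girth g = (Σ (Fin g → Fin n) (IsCycle g))
          × (∀ m (c : Fin m → Fin n) → IsCycle m c → g ≤ m)

  Equator : ℕ → Set
  Equator q = (Σ (Fin q → Fin n) (IsIsometricCycle q))
            × (∀ m (c : Fin m → Fin n) → IsIsometricCycle m c → m ≤ q)

kOf : ℕ → ℕ
kOf g = ((g + 1) / 2) ∸ 1

sumBelow : (ℕ → ℕ) → ℕ → ℕ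
sumBelow f zero    = 0
sumBelow f (suc k) = sumBelow f k + f k

Moore : ℕ → ℕ → ℕ
Moore δ g with g % 2
... | 1 = 1 + sumBelow (λ i → δ * (δ ∸ 1) ^ i) (kOf g)
... | _ = 2 + sumBelow (λ i → 2 * (δ ∸ 1) ^ suc i) (kOf g)

Equatorial : ∀ {n} → Graph n → ℕ → ℕ → ℕ → Set
Equatorial {n} G g δ q =
  (2 ≤ δ) × (3 ≤ g) × Girth G g × MinDegree G δ × Equator G q
  × (6 * kOf g + 3 < q) × (g * n ≡ q * Moore δ g)

at : ∀ {n q} → .{{_ : NonZero q}} → (Fin q → Fin n) → ℕ → Fin n
at {q = q} C j = C (j mod q)

-- v ∈ L_j = D_k(u_{j-k}) ∩ D_k(u_{j+k})   (j - k computed as j + q - k, mod q)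
InL : ∀ {n} → Graph n → (q k : ℕ) → .{{_ : NonZero q}} → (Fin q → Fin n) → ℕ → Fin n → Set
InL G q k C j v = Ball G k (at C (j + q ∸ k)) v × Ball G k (at C (j + k)) v

-- Write d = g − 1 and let B_a be D_k(u_a) if g is odd and D_k(e_a) if g is even.
-- Non-backtracking walks of length at most k from u_a (from the edge e_a) have distinct
-- endpoints, since two of them ending at the same vertex would close a cycle shorter than g;
-- counting them gives |B_a| ≥ M(δ,g), hence Σ_a |B_a| ≥ q·M(δ,g) = g·n.
-- On the other hand, for a fixed vertex v, as C is isometric any two indices a, b with
-- v ∈ B_a ∩ B_b are within cyclic distance d, and as 3d < q these indices lie in an arc of at
-- most d + 1 = g consecutive indices. Double counting leaves no slack, so the indices a with
-- v ∈ B_a form an arc [e − d, e] of exactly g indices. Finally v ∈ L_j says that j − k and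
-- j + k are the two ends of this arc (for even g, where D_k(u_x) lies in B_{x−1} ∩ B_x, the arc
-- is [j − k − 1, j + k]); so v ∈ B_i iff i lies in the arc iff j lies in the window of the claim.

module Submission where

open import Defs hiding (sym)
open import Data.Nat using (ℕ; suc; _+_; _*_; _∸_; _≤_; _%_; NonZero)
open import Data.Nat.Base
import Data.Nat.Properties
open import Data.Fin using (Fin; toℕ)
open import Data.Product using (∃; _×_; _,_)
open import Function.Bundles using (_⇔_)
open import Relation.Binary.PropositionalEquality using (_≡_)
open import Relation.Unary using (Pred; Decidable)

module Counting where

  open import Data.Bool.Base using (true; false; if_then_else_)
  open import Data.Bool.Properties using (∧-identityʳ)
  open import Data.Fin.Base using (Fin; zero; suc)
  open import Data.Fin.Properties using (_≟_; suc-injective; 0≢1+n)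
  open import Data.List.Base using (List; []; _∷_; length; map; filter; tabulate; concatMap)
  open import Data.List.Properties using (length-++)
  open import Data.List.Relation.Unary.All as All using (All; []; _∷_)
  import Data.List.Relation.Unary.All.Properties as All
  open import Data.List.Relation.Unary.AllPairs using ([]; _∷_)
  open import Data.List.Relation.Unary.Unique.Propositional using (Unique)
  open import Data.Nat.Properties
    using (+-suc; +-mono-≤; +-monoˡ-≤; +-monoʳ-≤; +-cancelˡ-≤; +-cancelʳ-≤; *-suc; *-zeroʳ;
           ≤-trans; ≤-reflexive; m∸n≤m; module ≤-Reasoning; +-0-commutativeMonoid)
  open import Function.Base using (_∘_)
  open import Level using (Level)
  open import Relation.Binary.PropositionalEquality using (_≢_; refl; sym; cong)
  open import Relation.Nullary.Decidable using (Dec; yes; no; does)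
  open import Relation.Nullary.Negation using (contradiction)
  open import Relation.Unary using (Pred; Decidable; ∁; _∩_)
  open import Relation.Unary.Properties using (U?; ∁?; _∩?_)

  open import Algebra.Properties.CommutativeMonoid.Sum +-0-commutativeMonoid
    using (sum; sum-cong-≗; ∑-comm) public

  private
    variable
      ℓ ℓ′ : Level
      m n : ℕ

  indicator : {A : Set ℓ} → Dec A → ℕ
  indicator a? = if does a? then 1 else 0

  count : {P : Pred (Fin n) ℓ} → Decidable P → ℕ
  count P? = sum (λ x → indicator (P? x))

  count-remove : {P : Pred (Fin n) ℓ} (P? : Decidable P) {x : Fin n} → P x →
                 count P? ≡ suc (count (P? ∩? ∁? (_≟ x)))
  count-remove P? {zero} px with P? zero
  ... | yes _  = cong suc (sum-cong-≗ λ y → cong (λ b → if b then 1 else 0)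
                                                (sym (∧-identityʳ (does (P? (suc y))))))
  ... | no ¬px = contradiction px ¬px
  count-remove P? {suc x} px
    rewrite ∧-identityʳ (does (P? zero)) | count-remove (P? ∘ suc) px = +-suc _ _

  count-all : count {n} U? ≡ n
  count-all {zero}  = refl
  count-all {suc n} = cong suc count-all

  count-injective : {P : Pred (Fin m) ℓ} {Q : Pred (Fin n) ℓ′} (P? : Decidable P) (Q? : Decidable Q)
                    (f : ∀ x → P x → Fin n) → (∀ x px → Q (f x px)) →
                    (∀ x y px py → f x px ≡ f y py → x ≡ y) →
                    count P? ≤ count Q?
  count-injective {m = zero}  P? Q? f f-Q f-inj = z≤n
  count-injective {m = suc m} {Q = Q} P? Q? f f-Q f-inj with P? zero
  ... | no _   = count-injective (P? ∘ suc) Q? (f ∘ suc) (f-Q ∘ suc) f-inj′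
    where f-inj′ = λ x y px py → suc-injective ∘ f-inj (suc x) (suc y) px py
  ... | yes p₀ = begin
    suc (count (P? ∘ suc))              ≤⟨ s≤s (count-injective (P? ∘ suc) (Q? ∩? ∁? (_≟ y₀))
                                                                 (f ∘ suc) f-Q′ f-inj′) ⟩
    suc (count (Q? ∩? ∁? (_≟ y₀)))      ≡⟨ count-remove Q? (f-Q zero p₀) ⟨
    count Q?                            ∎
    where
    open ≤-Reasoning
    y₀ = f zero p₀
    f-inj′ = λ x y px py → suc-injective ∘ f-inj (suc x) (suc y) px py
    f-Q′ : ∀ x px → (Q ∩ ∁ (_≡ y₀)) (f (suc x) px)
    f-Q′ x px = f-Q (suc x) px , λ eq → 0≢1+n (sym (f-inj (suc x) zero px p₀ eq))

  count-mono : {P : Pred (Fin n) ℓ} {Q : Pred (Fin n) ℓ′} (P? : Decidable P) (Q? : Decidable Q) →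
               (∀ x → P x → Q x) → count P? ≤ count Q?
  count-mono P? Q? P⊆Q = count-injective P? Q? (λ x _ → x) P⊆Q (λ _ _ _ _ eq → eq)

  count-punctured : {P : Pred (Fin n) ℓ} (P? : Decidable P) {x : Fin n} →
                    count P? ∸ 1 ≤ count (P? ∩? ∁? (_≟ x))
  count-punctured P? {x} with P? x
  ... | yes px  = ≤-reflexive (cong (_∸ 1) (count-remove P? px))
  ... | no  ¬px = ≤-trans (m∸n≤m _ 1)
                    (count-mono P? (P? ∩? ∁? (_≟ x)) λ y py → py , λ { refl → ¬px py })

  length≤count : {P : Pred (Fin n) ℓ} (P? : Decidable P) {xs : List (Fin n)} →
                 Unique xs → All P xs → length xs ≤ count P?
  length≤count P? [] [] = z≤n
  length≤count P? {x ∷ xs} (x∉xs ∷ xs!) (px ∷ pxs) = begin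
    suc (length xs)                 ≤⟨ s≤s (length≤count (P? ∩? ∁? (_≟ x)) xs!
                                         (All.zipWith (λ (py , x≢y) → py , x≢y ∘ sym) (pxs , x∉xs))) ⟩
    suc (count (P? ∩? ∁? (_≟ x)))   ≡⟨ count-remove P? px ⟨
    count P?                        ∎
    where open ≤-Reasoning

  length-filter-tabulate : {A : Set} {P : Pred A ℓ} (P? : Decidable P) (f : Fin n → A) →
                           length (filter P? (tabulate f)) ≡ count (P? ∘ f)
  length-filter-tabulate {n = zero}  P? f = refl
  length-filter-tabulate {n = suc n} P? f with does (P? (f zero))
  ... | true  = cong suc (length-filter-tabulate P? (f ∘ suc))
  ... | false = length-filter-tabulate P? (f ∘ suc)

  unique-map : {A B : Set} {P : A → Set} {f : A → B} →
               (∀ {x y} → P x → P y → x ≢ y → f x ≢ f y) →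
               ∀ {xs} → All P xs → Unique xs → Unique (map f xs)
  unique-map f-inj []         []           = []
  unique-map f-inj (px ∷ pxs) (x∉xs ∷ xs!) =
    All.map⁺ (All.zipWith (λ (py , x≢y) → f-inj px py x≢y) (pxs , x∉xs)) ∷ unique-map f-inj pxs xs!

  length-concatMap-≥ : {A B : Set} (f : A → List B) {c : ℕ} → (∀ x → c ≤ length (f x)) →
                       ∀ xs → c * length xs ≤ length (concatMap f xs)
  length-concatMap-≥ f {c} c≤f []       = ≤-reflexive (*-zeroʳ c)
  length-concatMap-≥ f {c} c≤f (x ∷ xs) = begin
    c * suc (length xs)                      ≡⟨ *-suc c (length xs) ⟩
    c + c * length xs                        ≤⟨ +-mono-≤ (c≤f x) (length-concatMap-≥ f c≤f xs) ⟩
    length (f x) + length (concatMap f xs)   ≡⟨ length-++ (f x) ⟨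
    length (concatMap f (x ∷ xs))            ∎
    where open ≤-Reasoning

  n*c≤∑ : ∀ {c} (f : Fin n → ℕ) → (∀ i → c ≤ f i) → n * c ≤ sum f
  n*c≤∑ {zero}  f c≤f = z≤n
  n*c≤∑ {suc n} f c≤f = +-mono-≤ (c≤f zero) (n*c≤∑ (f ∘ suc) (c≤f ∘ suc))

  ∑≤n*c : ∀ {c} (f : Fin n → ℕ) → (∀ i → f i ≤ c) → sum f ≤ n * c
  ∑≤n*c {zero}  f f≤c = z≤n
  ∑≤n*c {suc n} f f≤c = +-mono-≤ (f≤c zero) (∑≤n*c (f ∘ suc) (f≤c ∘ suc))

  ∑-tight : ∀ {c} (f : Fin n → ℕ) → (∀ i → f i ≤ c) → n * c ≤ sum f → ∀ i → c ≤ f i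
  ∑-tight {suc n} {c} f f≤c n*c≤∑ = λ where
    zero    → +-cancelʳ-≤ _ _ _ (≤-trans n*c≤∑ (+-monoʳ-≤ (f zero) (∑≤n*c (f ∘ suc) (f≤c ∘ suc))))
    (suc i) → ∑-tight (f ∘ suc) (f≤c ∘ suc)
                (+-cancelˡ-≤ c _ _ (≤-trans n*c≤∑ (+-monoˡ-≤ (sum (f ∘ suc)) (f≤c zero)))) i

open Counting


module LeastElement where

  open import Data.Nat.Base
  open import Data.Nat.Properties using (m≤n⇒m<n∨m≡n)
  open import Data.Sum using (_⊎_; inj₁; inj₂; [_,_]′)
  open import Level using (Level)
  open import Relation.Binary.PropositionalEquality using (refl)
  open import Relation.Nullary.Decidable using (yes; no)
  open import Relation.Nullary.Negation using (¬_)
  open import Relation.Unary using (Pred; Decidable)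

  private
    variable
      p : Level

  record Least (P : Pred ℕ p) : Set p where
    field
      value   : ℕ
      holds   : P value
      minimal : ∀ {j} → j < value → ¬ P j

  private
    least-below : {P : Pred ℕ p} → Decidable P → ∀ n → (∀ {j} → j < n → ¬ P j) ⊎ Least P
    least-below P? zero = inj₁ λ ()
    least-below P? (suc n) with least-below P? n
    ... | inj₂ l    = inj₂ l
    ... | inj₁ none with P? n
    ...   | yes pn = inj₂ (record { value = n ; holds = pn ; minimal = none })
    ...   | no ¬pn = inj₁ λ j<1+n → [ none , (λ { refl → ¬pn }) ]′ (m≤n⇒m<n∨m≡n (s≤s⁻¹ j<1+n))

  least : {P : Pred ℕ p} → Decidable P → ∀ {n} → P n → Least P
  least P? {n} pn with least-below P? n
  ... | inj₁ none = record { value = n ; holds = pn ; minimal = none }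
  ... | inj₂ l    = l

open LeastElement


module Modular (q : ℕ) .{{_ : NonZero q}} where

  open import Algebra.Properties.CommutativeSemigroup (Data.Nat.Properties.+-commutativeSemigroup)
    using (x∙yz≈y∙xz; xy∙z≈xz∙y; xy∙z≈y∙xz)
  open import Data.Fin.Base using (Fin; toℕ)
  open import Data.Fin.Properties using (toℕ-injective; toℕ-fromℕ<; toℕ<n)
  open import Data.Nat.DivMod using (_mod_; %-distribˡ-+; [m+n]%n≡m%n; m%n%n≡m%n; m%n<n; m<n⇒m%n≡m)
  open import Data.Nat.Properties
    using (+-comm; +-assoc; +-suc; +-identityʳ; ≤-total; <⇒≤; ≤-trans; m+[n∸m]≡n; m≤n⇒∣m-n∣≡n∸m;
           ∣-∣-comm; m≤n⇒m⊓n≡m; m≥n⇒m⊓n≡n; ≤-<-trans; +-monoʳ-≤; m≤n+m; m≤m+n; m∸n≤m; 1+n≢0; n≮n)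
  open import Data.Product using (∃-syntax; _×_; _,_)
  open import Data.Sum using (_⊎_; inj₁; inj₂)
  import Relation.Binary.Construct.On as On
  import Relation.Binary.Reasoning.Setoid
  open import Relation.Binary.Bundles using (Setoid)
  open import Relation.Binary.PropositionalEquality as ≡ using (_≡_; refl; cong)
  open import Relation.Nullary.Negation using (¬_)

  infix 4 _≡ₘ_
  _≡ₘ_ : ℕ → ℕ → Set
  x ≡ₘ y = x % q ≡ y % q

  ≡ₘ-setoid : Setoid _ _
  ≡ₘ-setoid = On.setoid {B = ℕ} (≡.setoid ℕ) (_% q)

  module ≡ₘ-Reasoning = Relation.Binary.Reasoning.Setoid ≡ₘ-setoid
  open ≡ₘ-Reasoning

  ≡⇒≡ₘ : ∀ {x y} → x ≡ y → x ≡ₘ y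
  ≡⇒≡ₘ = cong (_% q)

  %-≡ₘ : ∀ x → x % q ≡ₘ x
  %-≡ₘ x = m%n%n≡m%n x q

  +q-≡ₘ : ∀ x → x + q ≡ₘ x
  +q-≡ₘ x = [m+n]%n≡m%n x q

  +-congʳ-≡ₘ : ∀ {x y} z → x ≡ₘ y → x + z ≡ₘ y + z
  +-congʳ-≡ₘ {x} {y} z x≡y = begin
    x + z                       ≈⟨ %-distribˡ-+ x z q ⟩
    (x % q + z % q)             ≡⟨ cong (_+ z % q) x≡y ⟩
    (y % q + z % q)             ≈⟨ %-distribˡ-+ y z q ⟨
    y + z                       ∎

  +-congˡ-≡ₘ : ∀ x {y z} → y ≡ₘ z → x + y ≡ₘ x + z
  +-congˡ-≡ₘ x {y} {z} y≡z = begin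
    x + y  ≡⟨ +-comm x y ⟩
    y + x  ≈⟨ +-congʳ-≡ₘ x y≡z ⟩
    z + x  ≡⟨ +-comm z x ⟩
    x + z  ∎

  +-∸-≡ₘ : ∀ {r} x → r ≤ q → x + r + (q ∸ r) ≡ₘ x
  +-∸-≡ₘ {r} x r≤q = begin
    x + r + (q ∸ r)   ≡⟨ +-assoc x r _ ⟩
    x + (r + (q ∸ r)) ≡⟨ cong (x +_) (m+[n∸m]≡n r≤q) ⟩
    x + q             ≈⟨ +q-≡ₘ x ⟩
    x                 ∎

  move-+ʳ-≡ₘ : ∀ {x y r} → r ≤ q → x + r ≡ₘ y → x ≡ₘ y + (q ∸ r)
  move-+ʳ-≡ₘ {x} {y} {r} r≤q x+r≡y = begin
    x                  ≈⟨ +-∸-≡ₘ x r≤q ⟨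
    x + r + (q ∸ r)    ≈⟨ +-congʳ-≡ₘ (q ∸ r) x+r≡y ⟩
    y + (q ∸ r)        ∎

  +-cancelʳ-≡ₘ : ∀ {x y} z → z ≤ q → x + z ≡ₘ y + z → x ≡ₘ y
  +-cancelʳ-≡ₘ {x} {y} z z≤q x+z≡y+z = begin
    x                ≈⟨ move-+ʳ-≡ₘ z≤q x+z≡y+z ⟩
    y + z + (q ∸ z)  ≈⟨ +-∸-≡ₘ y z≤q ⟩
    y                ∎

  mod-≡ₘ : ∀ {x y} → x ≡ₘ y → x mod q ≡ y mod q
  mod-≡ₘ x≡y = toℕ-injective (≡.trans (toℕ-fromℕ< _) (≡.trans x≡y (≡.sym (toℕ-fromℕ< _))))

  toℕ-≡ₘ-injective : ∀ {i j : Fin q} → toℕ i ≡ₘ toℕ j → i ≡ j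
  toℕ-≡ₘ-injective {i} {j} i≡j =
    toℕ-injective (≡.trans (≡.sym (m<n⇒m%n≡m (toℕ<n i))) (≡.trans i≡j (m<n⇒m%n≡m (toℕ<n j))))

  toℕ-mod-≡ₘ : ∀ x → toℕ (x mod q) ≡ₘ x
  toℕ-mod-≡ₘ x = ≡.trans (cong (_% q) (toℕ-fromℕ< _)) (%-≡ₘ x)

  suc-cancel-≡ₘ : ∀ {x y} → suc x ≡ₘ suc y → x ≡ₘ y
  suc-cancel-≡ₘ {x} {y} x+1≡y+1 =
    +-cancelʳ-≡ₘ 1 (>-nonZero⁻¹ q) (≡.trans (≡⇒≡ₘ (+-comm x 1)) (≡.trans x+1≡y+1 (≡⇒≡ₘ (+-comm 1 y))))

  toℕ-suc-mod : ∀ x → toℕ (suc x mod q) ≡ suc (toℕ (x mod q)) % q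
  toℕ-suc-mod x = ≡.trans (toℕ-fromℕ< _)
                    (≡.trans (+-congˡ-≡ₘ 1 (≡.sym (%-≡ₘ x))) (cong (λ t → suc t % q) (≡.sym (toℕ-fromℕ< _))))

  fwd : ℕ → ℕ → ℕ
  fwd x y = (y + (q ∸ x % q)) % q

  private
    +-complement-≡ₘ : ∀ x y → y + (x + (q ∸ x % q)) ≡ₘ y
    +-complement-≡ₘ x y = begin
      y + (x + (q ∸ x % q))     ≈⟨ +-congˡ-≡ₘ y (+-congʳ-≡ₘ (q ∸ x % q) (%-≡ₘ x)) ⟨
      y + (x % q + (q ∸ x % q)) ≡⟨ cong (y +_) (m+[n∸m]≡n (<⇒≤ (m%n<n x q))) ⟩
      y + q                     ≈⟨ +q-≡ₘ y ⟩
      y                         ∎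

  +-fwd : ∀ x y → x + fwd x y ≡ₘ y
  +-fwd x y = begin
    x + fwd x y            ≈⟨ +-congˡ-≡ₘ x (%-≡ₘ _) ⟩
    x + (y + (q ∸ x % q))  ≡⟨ x∙yz≈y∙xz x y _ ⟩
    y + (x + (q ∸ x % q))  ≈⟨ +-complement-≡ₘ x y ⟩
    y                      ∎

  fwd-unique : ∀ {x y a} → a < q → x + a ≡ₘ y → fwd x y ≡ a
  fwd-unique {x} {y} {a} a<q x+a≡y = ≡.trans y+c≡a (m<n⇒m%n≡m a<q)
    where
    y+c≡a : y + (q ∸ x % q) ≡ₘ a
    y+c≡a = begin
      y + (q ∸ x % q)        ≈⟨ +-congʳ-≡ₘ (q ∸ x % q) x+a≡y ⟨
      x + a + (q ∸ x % q)    ≡⟨ xy∙z≈y∙xz x a _ ⟩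
      a + (x + (q ∸ x % q))  ≈⟨ +-complement-≡ₘ x a ⟩
      a                      ∎

  +-cancelˡ-≡ₘ : ∀ x {a b} → a < q → b < q → x + a ≡ₘ x + b → a ≡ b
  +-cancelˡ-≡ₘ x a<q b<q x+a≡x+b = ≡.trans (≡.sym (fwd-unique a<q x+a≡x+b)) (fwd-unique b<q refl)

  Near : ℕ → ℕ → ℕ → Set
  Near d x y = ∃[ r ] r ≤ d × (x + r ≡ₘ y ⊎ y + r ≡ₘ x)

  Near-sym : ∀ {d x y} → Near d x y → Near d y x
  Near-sym (r , r≤d , inj₁ x+r≡y) = r , r≤d , inj₂ x+r≡y
  Near-sym (r , r≤d , inj₂ y+r≡x) = r , r≤d , inj₁ y+r≡x

  Near-resp : ∀ {d x x′ y y′} → x ≡ₘ x′ → y ≡ₘ y′ → Near d x y → Near d x′ y′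
  Near-resp {x = x} {x′} x≡x′ y≡y′ (r , r≤d , inj₁ x+r≡y) =
    r , r≤d , inj₁ (≡.trans (≡.sym (+-congʳ-≡ₘ r x≡x′)) (≡.trans x+r≡y y≡y′))
  Near-resp x≡x′ y≡y′ (r , r≤d , inj₂ y+r≡x) =
    r , r≤d , inj₂ (≡.trans (≡.sym (+-congʳ-≡ₘ r y≡y′)) (≡.trans y+r≡x x≡x′))

  private
    Near-≤ : ∀ {a b d} → a ≤ b → b ≤ q → (b ∸ a) ⊓ (q ∸ (b ∸ a)) ≤ d → Near d a b
    Near-≤ {a} {b} a≤b b≤q dist≤d with ≤-total (b ∸ a) (q ∸ (b ∸ a))
    ... | inj₁ le = b ∸ a , ≡.subst (_≤ _) (m≤n⇒m⊓n≡m le) dist≤d ,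
                    inj₁ (≡⇒≡ₘ (m+[n∸m]≡n a≤b))
    ... | inj₂ ge = q ∸ (b ∸ a) , ≡.subst (_≤ _) (m≥n⇒m⊓n≡n ge) dist≤d ,
                    inj₂ (≡.trans (≡⇒≡ₘ (cong (_+ (q ∸ (b ∸ a))) (≡.sym (m+[n∸m]≡n a≤b))))
                                  (+-∸-≡ₘ a (≤-trans (m∸n≤m b a) b≤q)))

  cyclic-Near : ∀ {d} (i j : Fin q) → ∣ toℕ i - toℕ j ∣ ⊓ (q ∸ ∣ toℕ i - toℕ j ∣) ≤ d →
                Near d (toℕ i) (toℕ j)
  cyclic-Near i j dist≤d with ≤-total (toℕ i) (toℕ j)
  ... | inj₁ i≤j = Near-≤ i≤j (<⇒≤ (toℕ<n j))
                     (≡.subst (λ t → t ⊓ (q ∸ t) ≤ _) (m≤n⇒∣m-n∣≡n∸m i≤j) dist≤d)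
  ... | inj₂ j≤i = Near-sym (Near-≤ j≤i (<⇒≤ (toℕ<n i))
                     (≡.subst (λ t → t ⊓ (q ∸ t) ≤ _)
                        (≡.trans (∣-∣-comm (toℕ i) (toℕ j)) (m≤n⇒∣m-n∣≡n∸m j≤i)) dist≤d))

  Near-suc⁻¹ : ∀ {d x y} → Near d (suc x) (suc y) → Near d x y
  Near-suc⁻¹ (r , r≤d , inj₁ x+1+r≡y+1) = r , r≤d , inj₁ (suc-cancel-≡ₘ x+1+r≡y+1)
  Near-suc⁻¹ (r , r≤d , inj₂ y+1+r≡x+1) = r , r≤d , inj₂ (suc-cancel-≡ₘ y+1+r≡x+1)

  ¬Near-beyond : ∀ {d} x → d + suc d < q → ¬ Near d x (x + suc d)
  ¬Near-beyond {d} x bound (r , r≤d , inj₁ x+r≡x+d+1) =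
    n≮n d (≡.subst (_≤ d) (+-cancelˡ-≡ₘ x r<q (≤-<-trans (m≤n+m (suc d) d) bound) x+r≡x+d+1) r≤d)
    where r<q = ≤-<-trans (≤-trans r≤d (m≤m+n d (suc d))) bound
  ¬Near-beyond {d} x bound (r , r≤d , inj₂ x+d+1+r≡x) =
    1+n≢0 (+-cancelˡ-≡ₘ x d+1+r<q (≤-<-trans z≤n bound)
            (≡.trans (≡⇒≡ₘ (≡.sym (+-assoc x (suc d) r)))
                     (≡.trans x+d+1+r≡x (≡⇒≡ₘ (≡.sym (+-identityʳ x))))))
    where d+1+r<q = ≤-<-trans (≡.subst (suc d + r ≤_) (+-comm (suc d) d) (+-monoʳ-≤ (suc d) r≤d)) bound


module Arc (q : ℕ) .{{_ : NonZero q}} {d : ℕ} (3d<q : d + d + d < q)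
  {ℓ} {S : Pred ℕ ℓ} (S? : Decidable S)
  (S-resp : ∀ {x y} → Modular._≡ₘ_ q x y → S x → S y)
  (S-near : ∀ {x y} → S x → S y → Modular.Near q d x y) where

  open import Data.Empty using (⊥-elim)
  open import Data.Fin.Base using (Fin; toℕ; fromℕ<)
  open import Data.Fin.Properties using (_≟_; toℕ-fromℕ<; any?)
  import Data.Nat.Properties
  open import Algebra.Properties.CommutativeSemigroup Data.Nat.Properties.+-commutativeSemigroup
    using (xy∙z≈xz∙y; x∙yz≈xz∙y)
  open import Data.Nat.Properties
    using (≤-refl; ≤-trans; ≤-reflexive; ≤-<-trans; <⇒≤; <⇒≱; ≮⇒≥; m≤m+n; m≤n+m; +-monoʳ-≤; +-monoˡ-≤;
           +-mono-≤; +-identityʳ; +-assoc; +-∸-assoc; m∸n+n≡m; m+[n∸m]≡n; m∸n≤m; ∸-cancelʳ-≡;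
           m≤n+o⇒m∸n≤o; n≤0⇒n≡0; suc-injective; +-suc)
  open import Data.Product using (∃-syntax; _×_; _,_)
  open import Data.Sum using (inj₁; inj₂)
  open import Data.Unit using (tt)
  open import Function.Base using (_∘_)
  open import Relation.Binary.PropositionalEquality as ≡ using (_≡_; _≢_; refl; cong; subst)
  open import Relation.Nullary.Decidable using (yes; no)
  open import Relation.Nullary.Negation using (¬_; contradiction)
  open import Relation.Unary.Properties using (U?; ∁?; _∩?_)

  open Modular q

  -- Indices are naturals read modulo q, and x + (q ∸ d) stands for x − d.

  private
    2d<q : d + d < q
    2d<q = ≤-<-trans (m≤m+n (d + d) d) 3d<q

    d<q : d < q
    d<q = ≤-<-trans (m≤m+n d d) 2d<q

    d≤q : d ≤ q
    d≤q = <⇒≤ d<q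

    ∸-+-∸ : ∀ {r} → r ≤ d → (q ∸ d) + (d ∸ r) ≡ q ∸ r
    ∸-+-∸ {r} r≤d = ≡.trans (≡.sym (+-∸-assoc (q ∸ d) r≤d)) (cong (_∸ r) (m∸n+n≡m d≤q))

  S-Fin? : Decidable {A = Fin q} (S ∘ toℕ)
  S-Fin? x = S? (toℕ x)

  -- Offsets are measured from b = c − d. Every point of S is near c, so its offset is at most 2d;
  -- as 3d < q, nearness of two points of S then means that their offsets differ by at most d.
  module Reference {c : ℕ} (Sc : S c) where

    b : ℕ
    b = c + (q ∸ d)

    offset : ℕ → ℕ
    offset = fwd b

    b+d≡c : b + d ≡ₘ c
    b+d≡c = ≡.trans (≡⇒≡ₘ (xy∙z≈xz∙y c (q ∸ d) d)) (+-∸-≡ₘ c d≤q)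

    S-offset : ∀ {x} → S x → S (b + offset x)
    S-offset {x} sx = S-resp (≡.sym (+-fwd b x)) sx

    offset≤2d : ∀ {x} → S x → offset x ≤ d + d
    offset≤2d {x} sx with S-near Sc sx
    ... | r , r≤d , inj₁ c+r≡x = ≤-trans (≤-reflexive (fwd-unique d+r<q b+[d+r]≡x)) (+-monoʳ-≤ d r≤d)
      where
      d+r<q : d + r < q
      d+r<q = ≤-<-trans (+-mono-≤ (m≤m+n d d) r≤d) 3d<q
      b+[d+r]≡x : b + (d + r) ≡ₘ x
      b+[d+r]≡x = ≡.trans (≡⇒≡ₘ (≡.sym (+-assoc b d r))) (≡.trans (+-congʳ-≡ₘ r b+d≡c) c+r≡x)
    ... | r , r≤d , inj₂ x+r≡c =
      ≤-trans (≤-reflexive (fwd-unique d∸r<q b+[d∸r]≡x)) (≤-trans (m∸n≤m d r) (m≤m+n d d))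
      where
      d∸r<q : d ∸ r < q
      d∸r<q = ≤-<-trans (m∸n≤m d r) d<q
      b+[d∸r]≡x : b + (d ∸ r) ≡ₘ x
      b+[d∸r]≡x = ≡.trans (≡⇒≡ₘ (≡.trans (+-assoc c (q ∸ d) (d ∸ r)) (cong (c +_) (∸-+-∸ r≤d))))
                          (≡.sym (move-+ʳ-≡ₘ (≤-trans r≤d d≤q) x+r≡c))

    offset-step : ∀ {x y r} → S x → r ≤ d → x + r ≡ₘ y → offset y ≡ offset x + r
    offset-step {x} {y} {r} sx r≤d x+r≡y = fwd-unique o+r<q b+[o+r]≡y
      where
      o+r<q : offset x + r < q
      o+r<q = ≤-<-trans (+-mono-≤ (offset≤2d sx) r≤d) 3d<q
      b+[o+r]≡y : b + (offset x + r) ≡ₘ y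
      b+[o+r]≡y = ≡.trans (≡⇒≡ₘ (≡.sym (+-assoc b (offset x) r)))
                          (≡.trans (+-congʳ-≡ₘ r (+-fwd b x)) x+r≡y)

    offset-spread : ∀ {x y} → S x → S y → offset x ≤ offset y + d
    offset-spread {x} {y} sx sy with S-near sx sy
    ... | r , r≤d , inj₁ x+r≡y =
      ≤-trans (m≤m+n (offset x) r)
              (≤-trans (≤-reflexive (≡.sym (offset-step sx r≤d x+r≡y))) (m≤m+n (offset y) d))
    ... | r , r≤d , inj₂ y+r≡x = ≤-trans (≤-reflexive (offset-step sy r≤d y+r≡x)) (+-monoʳ-≤ (offset y) r≤d)

    open Least (least (S? ∘ (b +_)) (S-resp (≡.sym b+d≡c) Sc)) public
      renaming (value to m; holds to S-m; minimal to below-m)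

    m≤d : m ≤ d
    m≤d = ≮⇒≥ λ d<m → below-m d<m (S-resp (≡.sym b+d≡c) Sc)

    m≤offset : ∀ {x} → S x → m ≤ offset x
    m≤offset sx = ≮⇒≥ λ offset<m → below-m offset<m (S-offset sx)

    offset≤m+d : ∀ {x} → S x → offset x ≤ m + d
    offset≤m+d {x} sx = subst (λ o → offset x ≤ o + d) (fwd-unique (≤-<-trans m≤d d<q) refl)
                      (offset-spread sx S-m)

    slot : ∀ (x : Fin q) → S (toℕ x) → Fin (suc d)
    slot x sx = fromℕ< (s≤s (m≤n+o⇒m∸n≤o (offset (toℕ x)) m (offset≤m+d sx)))

    slot-injective : ∀ x y sx sy → slot x sx ≡ slot y sy → x ≡ y
    slot-injective x y sx sy eq = toℕ-≡ₘ-injective (begin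
      toℕ x                 ≈⟨ +-fwd b (toℕ x) ⟨
      b + offset (toℕ x)    ≡⟨ cong (b +_) offset-eq ⟩
      b + offset (toℕ y)    ≈⟨ +-fwd b (toℕ y) ⟩
      toℕ y                 ∎)
      where
      open ≡ₘ-Reasoning
      offset-eq : offset (toℕ x) ≡ offset (toℕ y)
      offset-eq = ∸-cancelʳ-≡ (m≤offset sx) (m≤offset sy)
                    (≡.trans (≡.sym (toℕ-fromℕ< _)) (≡.trans (cong toℕ eq) (toℕ-fromℕ< _)))

    count≤ : count S-Fin? ≤ suc d
    count≤ = ≤-trans (count-injective S-Fin? (U? {A = Fin (suc d)}) slot (λ _ _ → tt) slot-injective)
                     (≤-reflexive count-all)

    filled : suc d ≤ count S-Fin? → ∀ {t} → t ≤ d → S (b + (m + t))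
    filled full {t} t≤d with S? (b + (m + t))
    ... | yes s = s
    ... | no ¬s = contradiction full (<⇒≱ (s≤s count≤d))
      where
      -- slot then injects S into the d slots other than t.
      t′ : Fin (suc d)
      t′ = fromℕ< (s≤s t≤d)
      slot≢t′ : ∀ x sx → slot x sx ≢ t′
      slot≢t′ x sx eq = ¬s (subst (λ o → S (b + o)) offset≡m+t (S-offset sx))
        where
        offset≡m+t : offset (toℕ x) ≡ m + t
        offset≡m+t = ≡.trans (≡.sym (m+[n∸m]≡n (m≤offset sx)))
                       (cong (m +_) (≡.trans (≡.sym (toℕ-fromℕ< _)) (≡.trans (cong toℕ eq) (toℕ-fromℕ< _))))
      count≤d : count S-Fin? ≤ d
      count≤d = ≤-trans (count-injective S-Fin? (U? ∩? ∁? (_≟ t′)) slot (λ x sx → tt , slot≢t′ x sx)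
                                         slot-injective)
                        (≤-reflexive (suc-injective (≡.trans (≡.sym (count-remove U? {t′} tt)) count-all)))

  arc-count≤ : count S-Fin? ≤ suc d
  arc-count≤ with any? S-Fin?
  ... | yes (x , sx) = Reference.count≤ sx
  ... | no ∄S = ≤-trans (count-injective S-Fin? (U? {A = Fin (suc d)}) impossible (λ _ _ → tt)
                          (λ x _ sx _ _ → ⊥-elim (∄S (x , sx))))
                        (≤-reflexive count-all)
    where
    impossible : ∀ x → S (toℕ x) → Fin (suc d)
    impossible x sx = ⊥-elim (∄S (x , sx))

  module Saturated (full : suc d ≤ count S-Fin?) where

    arc-around : ∀ {i} → S i → ∃[ t ] t ≤ d × S (i + t) × S (i + t + (q ∸ d))
    arc-around {i} si = m , m≤d , S-resp end≡i+m (filled full ≤-refl) ,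
                     subst S start≡ (filled full z≤n)
      where
      open Reference si
      end≡i+m : b + (m + d) ≡ₘ i + m
      end≡i+m = ≡.trans (≡⇒≡ₘ (x∙yz≈xz∙y b m d)) (+-congʳ-≡ₘ m b+d≡c)
      start≡ : b + (m + 0) ≡ i + m + (q ∸ d)
      start≡ = ≡.trans (cong (b +_) (+-identityʳ m)) (xy∙z≈xz∙y i (q ∸ d) m)

    arc-filled : ∀ {e t} → S e → S (e + (q ∸ d)) → t ≤ d → S (e + (q ∸ t))
    arc-filled {e} {t} se s-start t≤d = subst S end≡ (filled full (m∸n≤m d t))
      where
      open Reference se
      m≡0 : m ≡ 0
      m≡0 = n≤0⇒n≡0 (≮⇒≥ λ 0<m → below-m 0<m (subst S (≡.sym (+-identityʳ b)) s-start))
      end≡ : b + (m + (d ∸ t)) ≡ e + (q ∸ t)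
      end≡ = ≡.trans (cong (λ o → b + (o + (d ∸ t))) m≡0)
               (≡.trans (+-assoc e (q ∸ d) (d ∸ t)) (cong (e +_) (∸-+-∸ t≤d)))

  arc-isolated : d + suc d < q → ∀ {e} → S e → S (e + (q ∸ d)) → ¬ S (suc e) × ¬ S (e + (q ∸ suc d))
  arc-isolated bound {e} se s-start =
    (λ s-next → ¬Near-beyond start bound (Near-resp refl (≡.sym next≡) (S-near s-start s-next))) ,
    (λ s-prev → ¬Near-beyond prev bound (Near-resp refl (≡.sym prev≡) (S-near s-prev se)))
    where
    start = e + (q ∸ d)
    prev  = e + (q ∸ suc d)
    sd≤q : suc d ≤ q
    sd≤q = ≤-trans (m≤n+m (suc d) d) (<⇒≤ bound)
    next≡ : start + suc d ≡ₘ suc e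
    next≡ = ≡.trans (≡⇒≡ₘ (≡.trans (+-suc start d) (cong suc (≡.trans (+-assoc e (q ∸ d) d)
                                                      (cong (e +_) (m∸n+n≡m d≤q))))))
                    (+-congˡ-≡ₘ 1 (+q-≡ₘ e))
    prev≡ : prev + suc d ≡ₘ e
    prev≡ = ≡.trans (≡⇒≡ₘ (≡.trans (+-assoc e (q ∸ suc d) (suc d)) (cong (e +_) (m∸n+n≡m sd≤q)))) (+q-≡ₘ e)


module Walks {n : ℕ} (G : Graph n) where

  open import Data.Bool.Base using (T)
  open import Data.Fin.Base using (Fin)
  open import Data.Fin.Properties using (_≟_; any?)
  open import Data.Nat.Properties using (≤-trans; +-mono-≤)
  open import Data.Sum using (inj₁; inj₂)
  open import Relation.Binary.PropositionalEquality using (refl; subst)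
  open import Relation.Nullary.Decidable using (map′; _×-dec_; _⊎-dec_; T?)
  open import Relation.Unary using (Decidable)

  Adj : Fin n → Fin n → Set
  Adj u v = T (adj G u v)

  Adj-sym : ∀ {u v} → Adj u v → Adj v u
  Adj-sym {u} {v} = subst T (Graph.sym G u v)

  infixr 5 _++ʷ_

  _++ʷ_ : ∀ {u v w a b} → Walk G u v a → Walk G v w b → Walk G u w (a + b)
  nil      ++ʷ q = q
  cons e p ++ʷ q = cons e (p ++ʷ q)

  snocʷ : ∀ {u v w a} → Walk G u v a → Adj v w → Walk G u w (suc a)
  snocʷ nil        e = cons e nil
  snocʷ (cons e p) f = cons e (snocʷ p f)

  reverseʷ : ∀ {u v a} → Walk G u v a → Walk G v u a
  reverseʷ nil        = nil
  reverseʷ (cons e p) = snocʷ (reverseʷ p) (Adj-sym e)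

  ball-refl : ∀ {i u} → Ball G i u u
  ball-refl = 0 , z≤n , nil

  ball-sym : ∀ {i u v} → Ball G i u v → Ball G i v u
  ball-sym (ℓ , ℓ≤i , p) = ℓ , ℓ≤i , reverseʷ p

  ball-trans : ∀ {i j u v w} → Ball G i u v → Ball G j v w → Ball G (i + j) u w
  ball-trans (a , a≤i , p) (b , b≤j , q) = a + b , +-mono-≤ a≤i b≤j , p ++ʷ q

  ball-step : ∀ {i u v w} → Adj u v → Ball G i v w → Ball G (suc i) u w
  ball-step e (ℓ , ℓ≤i , p) = suc ℓ , s≤s ℓ≤i , cons e p

  ball-mono : ∀ {i j u v} → i ≤ j → Ball G i u v → Ball G j u v
  ball-mono i≤j (ℓ , ℓ≤i , p) = ℓ , ≤-trans ℓ≤i i≤j , p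

  ball? : ∀ i u → Decidable (Ball G i u)
  ball? zero u v = map′ (λ { refl → ball-refl }) (λ { (_ , z≤n , nil) → refl }) (u ≟ v)
  ball? (suc i) u v =
    map′ (λ { (inj₁ refl) → ball-refl ; (inj₂ (w , e , b)) → ball-step e b })
         (λ { (_ , _ , nil) → inj₁ refl ; (suc ℓ , s≤s ℓ≤i , cons e p) → inj₂ (_ , e , ℓ , ℓ≤i , p) })
         ((u ≟ v) ⊎-dec any? (λ w → T? (adj G u w) ×-dec ball? i w v))


module NonBacktracking {n : ℕ} (G : Graph n) where

  open import Data.Bool.Base using (T)
  open import Data.Fin.Base using (Fin; zero; suc; toℕ)
  open import Data.Fin.Properties using (_≟_)
  open import Data.List.Base using (List; []; _∷_; [_]; _++_; _ʳ++_; length; lookup)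
  open import Data.List.Membership.Propositional using (_∈_)
  open import Data.List.Membership.Propositional.Properties using (∈-lookup; ∈-∃++; ∈-++⁺ʳ)
  open import Data.List.Membership.DecPropositional (_≟_ {n}) using (_∈?_)
  open import Data.List.Properties using (length-++; length-ʳ++)
  open import Data.List.Relation.Unary.All as All using (All; []; _∷_)
  open import Data.List.Relation.Unary.All.Properties using (++⁻ˡ; ¬Any⇒All¬)
  open import Data.List.Relation.Unary.Any using (here; there)
  open import Data.List.Relation.Unary.AllPairs using ([]; _∷_)
  open import Data.List.Relation.Unary.Unique.Propositional using (Unique)
  open import Data.List.Relation.Unary.Unique.DecPropositional (_≟_ {n}) using (unique?)
  open import Data.Nat.Properties
    using (+-comm; +-suc; +-identityʳ; ≤-trans; ≤-reflexive; +-mono-≤; n≤1+n; m<n⇒m<1+n; m≤m+n; <⇒≱;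
           suc-injective)
  open import Data.Sum using (_⊎_; inj₁; inj₂)
  open import Data.Unit using (⊤)
  open import Relation.Binary.PropositionalEquality as ≡ using (_≡_; _≢_; refl; cong; cong₂; subst)
  open import Relation.Nullary.Decidable using (yes; no)
  open import Relation.Nullary.Negation using (¬_; contradiction)
  open import Function.Base using (_∘′_)

  open Walks G

  infix 4 _≢head_

  _≢head_ : Fin n → List (Fin n) → Set
  z ≢head []      = ⊤
  z ≢head (p ∷ _) = z ≢ p

  -- A walk is stored as the list of its vertices, most recent vertex first.
  data NonBacktracking : List (Fin n) → Set where
    []   : NonBacktracking []
    [-]  : ∀ {x} → NonBacktracking [ x ]
    step : ∀ {z y w} → Adj y z → z ≢head w → NonBacktracking (y ∷ w) → NonBacktracking (z ∷ y ∷ w)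

  endpoint : Fin n → List (Fin n) → Fin n
  endpoint x []      = x
  endpoint x (z ∷ _) = z

  NB-tail : ∀ {x w} → NonBacktracking (x ∷ w) → NonBacktracking w
  NB-tail [-]            = []
  NB-tail (step _ _ nb) = nb

  ≢head-prefix : ∀ e {z x r} → z ≢head (e ++ x ∷ r) → z ≢head (e ++ [ x ])
  ≢head-prefix []      z≢x = z≢x
  ≢head-prefix (_ ∷ _) z≢y = z≢y

  NB-prefix : ∀ e {x r} → NonBacktracking (e ++ x ∷ r) → NonBacktracking (e ++ [ x ])
  NB-prefix []          _                   = [-]
  NB-prefix (z ∷ [])    (step e _ _)        = step e _ [-]
  NB-prefix (z ∷ y ∷ e) (step a z≢p nb)     = step a (≢head-prefix e z≢p) (NB-prefix (y ∷ e) nb)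

  NB-suffix : ∀ e {w} → NonBacktracking (e ++ w) → NonBacktracking w
  NB-suffix []      nb = nb
  NB-suffix (_ ∷ e) nb = NB-suffix e (NB-tail nb)

  length-snoc : ∀ (e : List (Fin n)) x → length (e ++ [ x ]) ≡ suc (length e)
  length-snoc e x = ≡.trans (length-++ e) (+-comm (length e) 1)

  private
    NB-lookup : ∀ xs {y} → NonBacktracking (xs ++ [ y ]) →
                ∀ (a b : Fin (length xs)) → suc (toℕ a) ≡ toℕ b → Adj (lookup xs a) (lookup xs b)
    NB-lookup (x ∷ x′ ∷ xs) (step e _ _)  zero    (suc zero) refl = Adj-sym e
    NB-lookup (x ∷ x′ ∷ xs) (step _ _ nb) (suc a) (suc b)    eq   =
      NB-lookup (x′ ∷ xs) nb a b (suc-injective eq)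
    NB-lookup (x ∷ [])      _             zero    zero       ()
    NB-lookup (x ∷ x′ ∷ xs) _             zero    zero       ()
    NB-lookup (x ∷ x′ ∷ xs) _             zero    (suc (suc b)) ()

    NB-lookup-last : ∀ xs {y} → NonBacktracking (xs ++ [ y ]) →
                     ∀ (a : Fin (length xs)) → suc (toℕ a) ≡ length xs → Adj (lookup xs a) y
    NB-lookup-last (x ∷ [])      (step e _ _)  zero    refl = Adj-sym e
    NB-lookup-last (x ∷ x′ ∷ xs) (step _ _ nb) (suc a) eq   = NB-lookup-last (x′ ∷ xs) nb a (suc-injective eq)

    lookup-injective : ∀ {xs : List (Fin n)} → Unique xs → ∀ i j → lookup xs i ≡ lookup xs j → i ≡ j
    lookup-injective {_ ∷ _}  _          zero    zero    _  = refl
    lookup-injective {_ ∷ xs} (x∉xs ∷ _) zero    (suc j) eq = contradiction eq (All.lookup x∉xs (∈-lookup j))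
    lookup-injective {_ ∷ xs} (x∉xs ∷ _) (suc i) zero    eq =
      contradiction (≡.sym eq) (All.lookup x∉xs (∈-lookup i))
    lookup-injective {_ ∷ xs} (_ ∷ xs!)  (suc i) (suc j) eq = cong suc (lookup-injective xs! i j eq)

    unique-split : ∀ (as : List (Fin n)) {v bs} → Unique (as ++ v ∷ bs) → Unique (v ∷ as)
    unique-split []       _             = [] ∷ []
    unique-split (a ∷ as) (a∉ ∷ as!) with unique-split as as!
    ... | v∉as ∷ as!′ = (a≢v ∘′ ≡.sym ∷ v∉as) ∷ ++⁻ˡ as a∉ ∷ as!′
      where a≢v = All.lookup a∉ (∈-++⁺ʳ as (here refl))

  repeat-cycle : ∀ v as {bs} → NonBacktracking (v ∷ as ++ v ∷ bs) → Unique (v ∷ as) →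
          IsCycle G (suc (length as)) (lookup (v ∷ as))
  repeat-cycle v as {bs} nb v∷as! = three≤ as nb , lookup-injective v∷as! , adjacent
    where
    closed : NonBacktracking ((v ∷ as) ++ [ v ])
    closed = NB-prefix (v ∷ as) nb
    three≤ : ∀ as → NonBacktracking (v ∷ as ++ v ∷ bs) → 3 ≤ suc (length as)
    three≤ []           (step e _ _)      = contradiction (subst T (irrefl G v) e) λ ()
    three≤ (_ ∷ [])     (step _ v≢v _)    = contradiction refl v≢v
    three≤ (_ ∷ _ ∷ _)  _                 = s≤s (s≤s (s≤s z≤n))
    adjacent : ∀ a b → suc (toℕ a) ≡ toℕ b ⊎ (suc (toℕ a) ≡ suc (length as) × toℕ b ≡ 0) →
               Adj (lookup (v ∷ as) a) (lookup (v ∷ as) b)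
    adjacent a b       (inj₁ a+1≡b)   = NB-lookup (v ∷ as) closed a b a+1≡b
    adjacent a zero    (inj₂ (a+1≡m , _)) = NB-lookup-last (v ∷ as) closed a a+1≡m

  private
    Apart : List (Fin n) → List (Fin n) → Set
    Apart []      _   = ⊤
    Apart (a ∷ _) acc = a ≢head acc

    Apart-snoc : ∀ e₁ e₂ {x} → endpoint x e₁ ≢ endpoint x e₂ → Apart (e₁ ++ [ x ]) (e₂ ++ [ x ])
    Apart-snoc []      []      ne = ne
    Apart-snoc []      (_ ∷ _) ne = ne
    Apart-snoc (_ ∷ _) []      ne = ne
    Apart-snoc (_ ∷ _) (_ ∷ _) ne = ne

    NB-ʳ++ : ∀ {c} as {acc} → NonBacktracking (c ∷ as) → NonBacktracking (c ∷ acc) → Apart as acc →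
             NonBacktracking (as ʳ++ c ∷ acc)
    NB-ʳ++ []       _                 nb₂ _    = nb₂
    NB-ʳ++ (a ∷ as) (step e c≢a′ nb₁) nb₂ a≢b = NB-ʳ++ as nb₁ (step (Adj-sym e) a≢b nb₂) (apart as c≢a′)
      where
      apart : ∀ as {c acc} → c ≢head as → Apart as (c ∷ acc)
      apart []      _   = _
      apart (_ ∷ _) c≢a = c≢a ∘′ ≡.sym

    unique-ʳ++ : ∀ as {bs : List (Fin n)} → Unique (as ʳ++ bs) → Unique bs
    unique-ʳ++ []       bs! = bs!
    unique-ʳ++ (a ∷ as) abs! with unique-ʳ++ as abs!
    ... | _ ∷ bs! = bs!

    ¬unique-ʳ++ : ∀ as {bs : List (Fin n)} {x} → x ∈ as → x ∈ bs → ¬ Unique (as ʳ++ bs)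
    ¬unique-ʳ++ (a ∷ as) (here refl) x∈bs abs! with unique-ʳ++ as abs!
    ... | a∉bs ∷ _ = All.lookup a∉bs x∈bs refl
    ¬unique-ʳ++ (a ∷ as) (there x∈as) x∈bs abs! = ¬unique-ʳ++ as x∈as (there x∈bs) abs!

  module Girth {g : ℕ} (girth : ∀ m c → IsCycle G m c → g ≤ m) where

    -- The first vertex that reappears closes a cycle.
    repeat⇒girth<length : ∀ {L} → NonBacktracking L → ¬ Unique L → g < length L
    repeat⇒girth<length {[]}     _  ¬L! = contradiction [] ¬L!
    repeat⇒girth<length {v ∷ ws} nb ¬L! with unique? ws
    ... | no ¬ws! = m<n⇒m<1+n (repeat⇒girth<length (NB-tail nb) ¬ws!)
    ... | yes ws! with v ∈? ws
    ...   | no v∉ws = contradiction (¬Any⇒All¬ ws v∉ws ∷ ws!) ¬L!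
    ...   | yes v∈ws with ∈-∃++ v∈ws
    ...     | as , bs , refl =
      s≤s (≤-trans (girth _ _ (repeat-cycle v as nb (unique-split as ws!)))
                   (≤-trans (s≤s (m≤m+n (length as) (length bs))) (≤-reflexive (≡.sym (length-snoc-++ as)))))
      where
      length-snoc-++ : ∀ as → length (as ++ v ∷ bs) ≡ suc (length as + length bs)
      length-snoc-++ as = ≡.trans (length-++ as) (+-suc (length as) (length bs))

    -- After dropping the common final steps, one walk followed by the reverse of the other is a
    -- non-backtracking closed walk through x.
    same-endpoint⇒girth≤ : ∀ e₁ e₂ {x} → NonBacktracking (e₁ ++ [ x ]) → NonBacktracking (e₂ ++ [ x ]) →
                          e₁ ≢ e₂ → endpoint x e₁ ≡ endpoint x e₂ → g ≤ length e₁ + length e₂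
    same-endpoint⇒girth≤ [] [] _ _ e₁≢e₂ _ = contradiction refl e₁≢e₂
    same-endpoint⇒girth≤ [] (_ ∷ e₂) {x} _ nb₂ _ refl =
      ≤-trans (s≤s⁻¹ (repeat⇒girth<length nb₂ λ { (x∉ ∷ _) → All.lookup x∉ (∈-++⁺ʳ e₂ (here refl)) refl }))
              (≤-reflexive (length-snoc e₂ x))
    same-endpoint⇒girth≤ (_ ∷ e₁) [] {x} nb₁ _ _ refl =
      ≤-trans (s≤s⁻¹ (repeat⇒girth<length nb₁ λ { (x∉ ∷ _) → All.lookup x∉ (∈-++⁺ʳ e₁ (here refl)) refl }))
              (≤-reflexive (≡.trans (length-snoc e₁ x) (≡.sym (+-identityʳ _))))
    same-endpoint⇒girth≤ (a ∷ e₁) (_ ∷ e₂) {x} nb₁ nb₂ ne refl with endpoint x e₁ ≟ endpoint x e₂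
    ... | yes same = ≤-trans (same-endpoint⇒girth≤ e₁ e₂ (NB-tail nb₁) (NB-tail nb₂) (ne ∘′ cong (a ∷_)) same)
                             (+-mono-≤ (n≤1+n _) (n≤1+n _))
    ... | no apart = s≤s⁻¹ (≤-trans (repeat⇒girth<length closed-nb closed-repeats) (≤-reflexive length-eq))
      where
      closed-nb = NB-ʳ++ (e₁ ++ [ x ]) nb₁ nb₂ (Apart-snoc e₁ e₂ apart)
      closed-repeats = ¬unique-ʳ++ (e₁ ++ [ x ]) (∈-++⁺ʳ e₁ (here refl)) (there (∈-++⁺ʳ e₂ (here refl)))
      length-eq : length ((e₁ ++ [ x ]) ʳ++ a ∷ e₂ ++ [ x ]) ≡ suc (suc (length e₁ + suc (length e₂)))
      length-eq = ≡.trans (length-ʳ++ (e₁ ++ [ x ]))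
                    (≡.trans (cong₂ _+_ (length-snoc e₁ x) (cong suc (length-snoc e₂ x)))
                       (cong suc (+-suc (length e₁) (suc (length e₂)))))

    distinct-endpoints : ∀ {x e₁ e₂} → NonBacktracking (e₁ ++ [ x ]) → NonBacktracking (e₂ ++ [ x ]) →
                         length e₁ + length e₂ < g → e₁ ≢ e₂ → endpoint x e₁ ≢ endpoint x e₂
    distinct-endpoints {e₁ = e₁} {e₂} nb₁ nb₂ short e₁≢e₂ same =
      <⇒≱ short (same-endpoint⇒girth≤ e₁ e₂ nb₁ nb₂ e₁≢e₂ same)

  walk-back : ∀ e {x r} → NonBacktracking (e ++ x ∷ r) → Walk G (endpoint x e) x (length e)
  walk-back []          _            = nil
  walk-back (z ∷ [])    (step a _ _)  = cons (Adj-sym a) nil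
  walk-back (z ∷ y ∷ e) (step a _ nb) = cons (Adj-sym a) (walk-back (y ∷ e) nb)

  endpoint-snoc : ∀ e {x y} → endpoint y (e ++ [ x ]) ≡ endpoint x e
  endpoint-snoc []      = refl
  endpoint-snoc (_ ∷ _) = refl


module MooreBound {n : ℕ} (G : Graph n) (δ : ℕ) (min-degree : ∀ v → δ ≤ degree G v)
                  {g : ℕ} (girth : ∀ m c → IsCycle G m c → g ≤ m) where

  open import Data.Empty using (⊥)
  open import Data.Fin.Base using (Fin)
  open import Data.Fin.Properties using (_≟_)
  open import Data.List.Base using (List; []; _∷_; [_]; _++_; length; map; filter; concatMap; allFin)
  open import Data.List.Properties
    using (length-map; length-++; ++-identityʳ; ++-assoc; ∷-injectiveˡ; ∷-injectiveʳ)
  open import Data.List.Membership.Propositional.Properties using (∈-map⁻)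
  open import Data.List.Relation.Unary.All as All using (All; []; _∷_)
  import Data.List.Relation.Unary.All.Properties as All
  open import Data.List.Relation.Unary.AllPairs as AllPairs using ([]; _∷_)
  import Data.List.Relation.Unary.AllPairs.Properties as AllPairs
  open import Data.List.Relation.Unary.Unique.Propositional using (Unique)
  import Data.List.Relation.Unary.Unique.Propositional.Properties as Unique
  open import Data.List.Relation.Binary.Disjoint.Propositional using (Disjoint)
  open import Algebra.Properties.CommutativeSemigroup Data.Nat.Properties.*-commutativeSemigroup
    using (x∙yz≈y∙xz)
  open import Data.Nat.Properties
    using (≤-refl; ≤-trans; ≤-reflexive; +-mono-≤; *-monoʳ-≤; *-identityʳ; ∸-monoˡ-≤; m∸n≤m;
           +-assoc; +-suc; ≤-<-trans; <-irrefl; n≤1+n; module ≤-Reasoning)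
  open import Data.Nat.Tactic.RingSolver using (solve-∀)
  open import Data.Product using (proj₁)
  open import Data.Sum using (_⊎_; inj₁; inj₂)
  open import Data.Unit using (tt)
  open import Function.Base using (id; _∘_)
  open import Relation.Binary.PropositionalEquality as ≡ using (_≢_; refl; cong; cong₂; subst)
  open import Relation.Nullary.Decidable using (Dec; yes; no; _×-dec_; _⊎-dec_; ¬?; T?)

  open Walks G
  open NonBacktracking G
  open Girth girth

  Allowed : List (Fin n) → Fin n → Set
  Allowed []      _ = ⊥
  Allowed (y ∷ w) z = Adj y z × z ≢head w

  allowed? : ∀ w → Decidable (Allowed w)
  allowed? []      _ = no id
  allowed? (y ∷ w) z = T? (adj G y z) ×-dec ≢head? w
    where
    ≢head? : ∀ w → Dec (z ≢head w)
    ≢head? []      = yes tt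
    ≢head? (p ∷ _) = ¬? (z ≟ p)

  NB-extend : ∀ {w z} → NonBacktracking w → Allowed w z → NonBacktracking (z ∷ w)
  NB-extend {_ ∷ _} nb (a , z≢p) = step a z≢p nb

  degree-count : ∀ v → degree G v ≡ count (T? ∘ adj G v)
  degree-count v = length-filter-tabulate (T? ∘ adj G v) id

  count-Allowed : ∀ y w → δ ∸ 1 ≤ count (allowed? (y ∷ w))
  count-Allowed y []      = ≤-trans (m∸n≤m δ 1)
                              (≤-trans (min-degree y) (≤-trans (≤-reflexive (degree-count y))
                                (count-mono (T? ∘ adj G y) (allowed? [ y ]) (λ _ a → a , tt))))
  count-Allowed y (p ∷ w) = ≤-trans (∸-monoˡ-≤ 1 (≤-trans (min-degree y) (≤-reflexive (degree-count y))))
                              (count-punctured (T? ∘ adj G y))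

  -- The non-backtracking walks that continue the (reversed) walk x ∷ r, each stored
  -- as the list e of vertices added to it.
  module Extensions (x : Fin n) (r : List (Fin n)) (nb-s : NonBacktracking (x ∷ r)) where

    extend : List (Fin n) → List (List (Fin n))
    extend e = map (_∷ e) (filter (allowed? (e ++ x ∷ r)) (allFin n))

    layer : ℕ → List (List (Fin n))
    layer zero    = [ [] ]
    layer (suc i) = concatMap extend (layer i)

    walks : ℕ → List (List (Fin n))
    walks zero    = layer zero
    walks (suc k) = walks k ++ layer (suc k)

    extend-All : ∀ {e} → NonBacktracking (e ++ x ∷ r) →
                 All (λ e′ → length e′ ≡ suc (length e) × NonBacktracking (e′ ++ x ∷ r)) (extend e)
    extend-All {e} nb = All.map⁺ (All.map (λ allowed → refl , NB-extend nb allowed)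
                                          (All.all-filter (allowed? (e ++ x ∷ r)) (allFin n)))

    layer-All : ∀ i → All (λ e → length e ≡ i × NonBacktracking (e ++ x ∷ r)) (layer i)
    layer-All zero    = (refl , nb-s) ∷ []
    layer-All (suc i) =
      All.concat⁺ (All.map⁺ (All.map (λ { (refl , nb) → extend-All nb }) (layer-All i)))

    walks-All : ∀ k → All (λ e → length e ≤ k × NonBacktracking (e ++ x ∷ r)) (walks k)
    walks-All zero    = (z≤n , nb-s) ∷ []
    walks-All (suc k) = All.++⁺ (All.map (λ (len≤ , nb) → ≤-trans len≤ (n≤1+n k) , nb) (walks-All k))
                                (All.map (λ (len≡ , nb) → ≤-reflexive len≡ , nb) (layer-All (suc k)))

    extend-unique : ∀ e → Unique (extend e)
    extend-unique e =
      Unique.map⁺ ∷-injectiveˡ (Unique.filter⁺ (allowed? (e ++ x ∷ r)) (Unique.allFin⁺ n))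

    extend-disjoint : ∀ {e₁ e₂} → e₁ ≢ e₂ → Disjoint (extend e₁) (extend e₂)
    extend-disjoint e₁≢e₂ (e∈₁ , e∈₂) with ∈-map⁻ (_∷ _) e∈₁ | ∈-map⁻ (_∷ _) e∈₂
    ... | _ , _ , refl | _ , _ , eq = e₁≢e₂ (∷-injectiveʳ eq)

    layer-unique : ∀ i → Unique (layer i)
    layer-unique zero    = [] ∷ []
    layer-unique (suc i) = Unique.concat⁺ (All.map⁺ (All.tabulate λ {e} _ → extend-unique e))
                                          (AllPairs.map⁺ (AllPairs.map extend-disjoint (layer-unique i)))

    walks-unique : ∀ k → Unique (walks k)
    walks-unique zero    = layer-unique zero
    walks-unique (suc k) = Unique.++⁺ (walks-unique k) (layer-unique (suc k)) λ (e∈walks , e∈layer) →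
      <-irrefl (proj₁ (All.lookup (layer-All (suc k)) e∈layer))
               (s≤s (proj₁ (All.lookup (walks-All k) e∈walks)))

    length-extend : ∀ e → length (extend e) ≡ count (allowed? (e ++ x ∷ r))
    length-extend e = ≡.trans (length-map (_∷ e) (filter (allowed? (e ++ x ∷ r)) (allFin n)))
                              (length-filter-tabulate (allowed? (e ++ x ∷ r)) id)

    layer-step : ∀ i → (δ ∸ 1) * length (layer i) ≤ length (layer (suc i))
    layer-step i = length-concatMap-≥ extend extend-length (layer i)
      where
      extend-length : ∀ e → δ ∸ 1 ≤ length (extend e)
      extend-length []      = ≤-trans (count-Allowed x r) (≤-reflexive (≡.sym (length-extend [])))
      extend-length (z ∷ e) =
        ≤-trans (count-Allowed z (e ++ x ∷ r)) (≤-reflexive (≡.sym (length-extend (z ∷ e))))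

    layer-power : ∀ i → (δ ∸ 1) ^ i ≤ length (layer i)
    layer-power zero    = ≤-refl
    layer-power (suc i) = ≤-trans (*-monoʳ-≤ (δ ∸ 1) (layer-power i)) (layer-step i)

    walks-length : ∀ (f : ℕ → ℕ) → (∀ i → f i ≤ length (layer (suc i))) →
                   ∀ k → 1 + sumBelow f k ≤ length (walks k)
    walks-length f f≤ zero    = ≤-refl
    walks-length f f≤ (suc k) = begin
      1 + (sumBelow f k + f k)                    ≡⟨ +-assoc 1 (sumBelow f k) (f k) ⟨
      1 + sumBelow f k + f k                      ≤⟨ +-mono-≤ (walks-length f f≤ k) (f≤ k) ⟩
      length (walks k) + length (layer (suc k))   ≡⟨ length-++ (walks k) ⟨
      length (walks (suc k))                      ∎
      where open ≤-Reasoning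

    endpoints : ℕ → List (Fin n)
    endpoints k = map (endpoint x) (walks k)

    endpoints-in-ball : ∀ k → All (Ball G k x) (endpoints k)
    endpoints-in-ball k =
      All.map⁺ (All.map (λ {e} (len≤ , nb) → ball-sym (length e , len≤ , walk-back e nb)) (walks-All k))

  moore-bound-vertex : ∀ x {k} → k + k < g → 1 + sumBelow (λ i → δ * (δ ∸ 1) ^ i) k ≤ count (ball? k x)
  moore-bound-vertex x {k} 2k<g = begin
    1 + sumBelow (λ i → δ * (δ ∸ 1) ^ i) k  ≤⟨ walks-length _ first-layers k ⟩
    length (walks k)                        ≡⟨ length-map (endpoint x) (walks k) ⟨
    length (endpoints k)                    ≤⟨ length≤count (ball? k x) endpoints-unique
                                                                 (endpoints-in-ball k) ⟩
    count (ball? k x)                       ∎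
    where
    open ≤-Reasoning
    open Extensions x [] [-]
    first-layers : ∀ i → δ * (δ ∸ 1) ^ i ≤ length (layer (suc i))
    first-layers zero    = begin
      δ * 1                        ≡⟨ *-identityʳ δ ⟩
      δ                            ≤⟨ min-degree x ⟩
      degree G x                   ≡⟨ degree-count x ⟩
      count (T? ∘ adj G x)         ≤⟨ count-mono (T? ∘ adj G x) (allowed? [ x ]) (λ _ a → a , tt) ⟩
      count (allowed? [ x ])       ≡⟨ length-extend [] ⟨
      length (extend [])           ≡⟨ cong length (++-identityʳ (extend [])) ⟨
      length (layer 1)             ∎
    first-layers (suc i) = ≤-trans (≤-reflexive (x∙yz≈y∙xz δ (δ ∸ 1) ((δ ∸ 1) ^ i)))
                             (≤-trans (*-monoʳ-≤ (δ ∸ 1) (first-layers i)) (layer-step (suc i)))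
    endpoints-unique : Unique (endpoints k)
    endpoints-unique = unique-map (λ (len₁ , nb₁) (len₂ , nb₂) →
                                     distinct-endpoints nb₁ nb₂ (≤-<-trans (+-mono-≤ len₁ len₂) 2k<g))
                                  (walks-All k) (walks-unique k)

  sumBelow-double : ∀ h k → sumBelow (λ i → 2 * h i) k ≡ sumBelow h k + sumBelow h k
  sumBelow-double h zero    = refl
  sumBelow-double h (suc k) =
    ≡.trans (cong (_+ 2 * h k) (sumBelow-double h k)) (regroup (sumBelow h k) (h k))
    where
    regroup : ∀ a b → (a + a) + 2 * b ≡ (a + b) + (a + b)
    regroup = solve-∀

  -- Walks from the edge u w: those starting w, u, … end in D_k(u), those starting u, w, … in D_k(w).
  module EdgeWalks {u w : Fin n} (u~w : Adj u w) (k : ℕ) (2k+1<g : suc (k + k) < g) where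

    module A = Extensions u [ w ] (step (Adj-sym u~w) tt [-])
    module B = Extensions w [ u ] (step u~w tt [-])

    endpoints : List (Fin n)
    endpoints = A.endpoints k ++ B.endpoints k

    endpoints-length : 2 + sumBelow (λ i → 2 * (δ ∸ 1) ^ suc i) k ≤ length endpoints
    endpoints-length = begin
      2 + sumBelow (λ i → 2 * (δ ∸ 1) ^ suc i) k ≡⟨ cong (2 +_) (sumBelow-double (λ i → (δ ∸ 1) ^ suc i) k) ⟩
      2 + (S + S)                                 ≡⟨ cong suc (+-suc S S) ⟨
      (1 + S) + (1 + S)                           ≤⟨ +-mono-≤ (A.walks-length _ (A.layer-power ∘ suc) k)
                                                              (B.walks-length _ (B.layer-power ∘ suc) k) ⟩
      length (A.walks k) + length (B.walks k)     ≡⟨ cong₂ _+_ (length-map (endpoint u) (A.walks k))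
                                                               (length-map (endpoint w) (B.walks k)) ⟨
      length (A.endpoints k) + length (B.endpoints k) ≡⟨ length-++ (A.endpoints k) ⟨
      length endpoints                            ∎
      where
      open ≤-Reasoning
      S = sumBelow (λ i → (δ ∸ 1) ^ suc i) k

    endpoints-in-balls : All (λ v → Ball G k u v ⊎ Ball G k w v) endpoints
    endpoints-in-balls = All.++⁺ (All.map inj₁ (A.endpoints-in-ball k)) (All.map inj₂ (B.endpoints-in-ball k))

    private
      same-side : ∀ {x y e₁ e₂} → length e₁ ≤ k × NonBacktracking (e₁ ++ x ∷ [ y ]) →
                  length e₂ ≤ k × NonBacktracking (e₂ ++ x ∷ [ y ]) → e₁ ≢ e₂ → endpoint x e₁ ≢ endpoint x e₂
      same-side {e₁ = e₁} {e₂} (len₁ , nb₁) (len₂ , nb₂) =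
        distinct-endpoints (NB-prefix e₁ nb₁) (NB-prefix e₂ nb₂)
          (≤-<-trans (+-mono-≤ len₁ len₂) (≤-<-trans (n≤1+n _) 2k+1<g))

      -- The A-walk w, u, …, v and the B-walk u, w, …, v without its first vertex are distinct
      -- walks from w to v (were they equal, the B-walk would backtrack), of total length ≤ 2k + 1.
      across : Disjoint (A.endpoints k) (B.endpoints k)
      across (v∈A , v∈B) with ∈-map⁻ (endpoint u) v∈A | ∈-map⁻ (endpoint w) v∈B
      ... | eA , eA∈ , refl | eB , eB∈ , same
            with All.lookup (A.walks-All k) eA∈ | All.lookup (B.walks-All k) eB∈
      ... | lenA , nbA | lenB , nbB =
        distinct-endpoints {e₁ = eA ++ [ u ]}
          (subst NonBacktracking (≡.sym (++-assoc eA [ u ] [ w ])) nbA) (NB-prefix eB nbB)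
          (≤-<-trans (≤-trans (≤-reflexive (cong (_+ length eB) (length-snoc eA u)))
                              (s≤s (+-mono-≤ lenA lenB)))
                     2k+1<g)
          backtracks (≡.trans (endpoint-snoc eA) same)
        where
        backtracks : eA ++ [ u ] ≢ eB
        backtracks refl with NB-suffix eA (subst NonBacktracking (++-assoc eA [ u ] (w ∷ [ u ])) nbB)
        ... | step _ u≢u _ = u≢u refl

    endpoints-unique : Unique endpoints
    endpoints-unique = Unique.++⁺ (unique-map same-side (A.walks-All k) (A.walks-unique k))
                                  (unique-map same-side (B.walks-All k) (B.walks-unique k)) across

  moore-bound-edge : ∀ {u w k} → Adj u w → suc (k + k) < g →
                     2 + sumBelow (λ i → 2 * (δ ∸ 1) ^ suc i) k ≤ count (λ v → ball? k u v ⊎-dec ball? k w v)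
  moore-bound-edge {u} {w} {k} u~w 2k+1<g =
    ≤-trans endpoints-length
            (length≤count (λ v → ball? k u v ⊎-dec ball? k w v) endpoints-unique endpoints-in-balls)
    where open EdgeWalks u~w k 2k+1<g


module Parity where

  open import Data.Nat.Base
  open import Data.Nat.DivMod using (m≡m%n+[m/n]*n; m*n/n≡m; +-distrib-/; m*n%n≡0)
  open import Data.Nat.Properties using (+-comm; *-comm; +-identityʳ)
  open import Relation.Binary.PropositionalEquality as ≡ using (_≡_; refl; cong; subst; module ≡-Reasoning)
  open import Relation.Nullary.Negation using (contradiction)

  private
    *2 : ∀ m → m * 2 ≡ m + m
    *2 m = ≡.trans (*-comm m 2) (cong (m +_) (+-identityʳ m))

  odd⇒g≡1+2k : ∀ g → g % 2 ≡ 1 → g ≡ suc (kOf g + kOf g)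
  odd⇒g≡1+2k g g%2≡1 = ≡.trans g≡1+2m (cong suc (≡.trans (*2 m) (cong (λ k → k + k) (≡.sym k≡m))))
    where
    open ≡-Reasoning
    m = g / 2
    g≡1+2m : g ≡ suc (m * 2)
    g≡1+2m = ≡.trans (m≡m%n+[m/n]*n g 2) (cong (_+ m * 2) g%2≡1)
    k≡m : kOf g ≡ m
    k≡m = begin
      (g + 1) / 2 ∸ 1          ≡⟨ cong (λ x → (x + 1) / 2 ∸ 1) g≡1+2m ⟩
      (suc (m * 2) + 1) / 2 ∸ 1 ≡⟨ cong (λ x → x / 2 ∸ 1) (+-comm (suc (m * 2)) 1) ⟩
      suc m * 2 / 2 ∸ 1         ≡⟨ cong (_∸ 1) (m*n/n≡m (suc m) 2) ⟩
      m                         ∎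

  even⇒g≡2+2k : ∀ g → g % 2 ≡ 0 → 3 ≤ g → g ≡ suc (suc (kOf g + kOf g))
  even⇒g≡2+2k g g%2≡0 3≤g = from-half (g / 2) g≡2m k≡m∸1
    where
    open ≡-Reasoning
    g≡2m : g ≡ g / 2 * 2
    g≡2m = ≡.trans (m≡m%n+[m/n]*n g 2) (cong (_+ g / 2 * 2) g%2≡0)
    k≡m∸1 : kOf g ≡ g / 2 ∸ 1
    k≡m∸1 = begin
      (g + 1) / 2 ∸ 1               ≡⟨ cong (λ x → (x + 1) / 2 ∸ 1) g≡2m ⟩
      (g / 2 * 2 + 1) / 2 ∸ 1       ≡⟨ cong (_∸ 1) (+-distrib-/ (g / 2 * 2) 1
                                         (subst (λ r → r + 1 < 2) (≡.sym (m*n%n≡0 (g / 2) 2)) ≤-refl′)) ⟩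
      (g / 2 * 2 / 2 + 0) ∸ 1       ≡⟨ cong (λ x → x + 0 ∸ 1) (m*n/n≡m (g / 2) 2) ⟩
      (g / 2 + 0) ∸ 1               ≡⟨ cong (_∸ 1) (+-identityʳ (g / 2)) ⟩
      g / 2 ∸ 1                     ∎
      where ≤-refl′ = s≤s (s≤s z≤n)
    from-half : ∀ m → g ≡ m * 2 → kOf g ≡ m ∸ 1 → g ≡ suc (suc (kOf g + kOf g))
    from-half zero          g≡0 _   = contradiction (subst (3 ≤_) g≡0 3≤g) λ ()
    from-half (suc zero)    g≡2 _   = contradiction (subst (3 ≤_) g≡2 3≤g) λ { (s≤s (s≤s ())) }
    from-half (suc (suc m)) g≡m2 k≡ =
      ≡.trans g≡m2 (cong (suc ∘ suc) (≡.trans (*2 (suc m)) (cong (λ k → k + k) (≡.sym k≡))))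
      where open import Function.Base using (_∘_)

  Moore-odd : ∀ δ g → g % 2 ≡ 1 → Moore δ g ≡ 1 + sumBelow (λ i → δ * (δ ∸ 1) ^ i) (kOf g)
  Moore-odd δ g g%2≡1 with g % 2
  Moore-odd δ g refl | .1 = refl

  Moore-even : ∀ δ g → g % 2 ≡ 0 → Moore δ g ≡ 2 + sumBelow (λ i → 2 * (δ ∸ 1) ^ suc i) (kOf g)
  Moore-even δ g g%2≡0 with g % 2
  Moore-even δ g refl | .0 = refl

open Parity


module DoubleCounting {q n d M : ℕ} .{{_ : NonZero q}} (3d<q : d + d + d < q)
  {P : ℕ → Fin n → Set} (P? : ∀ x → Decidable (P x))
  (P-resp : ∀ {x y v} → Modular._≡ₘ_ q x y → P x v → P y v)
  (P-near : ∀ {x y v} → P x v → P y v → Modular.Near q d x y)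
  (lower : ∀ (a : Fin q) → M ≤ count (P? (toℕ a)))
  (balance : suc d * n ≡ q * M) where

  open import Data.Nat.Properties using (*-comm; module ≤-Reasoning)
  open import Function.Base using (flip)
  open import Relation.Binary.PropositionalEquality as ≡ using ()

  module ArcAt (v : Fin n) = Arc q 3d<q (flip P? v) P-resp P-near

  arcs-saturated : ∀ v → suc d ≤ count (ArcAt.S-Fin? v)
  arcs-saturated = ∑-tight (λ v → count (ArcAt.S-Fin? v)) (λ v → ArcAt.arc-count≤ v) (begin
    n * suc d                                     ≡⟨ ≡.trans (*-comm n (suc d)) balance ⟩
    q * M                                         ≤⟨ n*c≤∑ (λ a → count (P? (toℕ a))) lower ⟩
    sum (λ (a : Fin q) → count (P? (toℕ a)))      ≡⟨ ∑-comm (λ (a : Fin q) v → indicator (P? (toℕ a) v)) ⟩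
    sum (λ v → count (ArcAt.S-Fin? v))            ∎)
    where open ≤-Reasoning


module CycleIndex {n : ℕ} (G : Graph n) {q : ℕ} .{{_ : NonZero q}} (C : Fin q → Fin n)
                  (iso : IsIsometricCycle G q C) where

  open import Data.Fin.Properties using (toℕ<n)
  open import Data.Nat.DivMod using (_mod_; m<n⇒m%n≡m; n%n≡0)
  open import Data.Nat.Properties using (≤-trans; m≤n⇒m<n∨m≡n)
  open import Data.Product using (_,_; proj₁; proj₂)
  open import Data.Sum using (_⊎_; inj₁; inj₂)
  open import Relation.Binary.PropositionalEquality as ≡ using (cong)

  open Modular q
  open Walks G

  at-≡ₘ : ∀ {x y} → x ≡ₘ y → at C x ≡ at C y
  at-≡ₘ x≡y = cong C (mod-≡ₘ x≡y)

  ball⇒Near : ∀ {ℓ x y} → Ball G ℓ (at C x) (at C y) → Near ℓ x y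
  ball⇒Near {x = x} {y} (ℓ′ , ℓ′≤ℓ , p) =
    Near-resp (toℕ-mod-≡ₘ x) (toℕ-mod-≡ₘ y)
      (cyclic-Near (x mod q) (y mod q) (≤-trans (proj₂ (proj₂ iso (x mod q) (y mod q)) ℓ′ p) ℓ′≤ℓ))

  at-adjacent : ∀ x → Adj (at C x) (at C (suc x))
  at-adjacent x = proj₂ (proj₂ (proj₁ iso)) (x mod q) (suc x mod q) consecutive
    where
    consecutive : suc (toℕ (x mod q)) ≡ toℕ (suc x mod q) ⊎
                  (suc (toℕ (x mod q)) ≡ q × toℕ (suc x mod q) ≡ 0)
    consecutive with m≤n⇒m<n∨m≡n (toℕ<n (x mod q))
    ... | inj₁ x+1<q = inj₁ (≡.sym (≡.trans (toℕ-suc-mod x) (m<n⇒m%n≡m x+1<q)))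
    ... | inj₂ x+1≡q = inj₂ (x+1≡q , ≡.trans (toℕ-suc-mod x) (≡.trans (cong (_% q) x+1≡q) (n%n≡0 q)))


module EquatorialCycle {n : ℕ} (G : Graph n) {g δ q : ℕ} .{{_ : NonZero q}}
  (C : Fin q → Fin n) (iso : IsIsometricCycle G q C)
  (girth : ∀ m c → IsCycle G m c → g ≤ m) (min-degree : ∀ v → δ ≤ degree G v)
  (q-large : 6 * kOf g + 3 < q) (balance : g * n ≡ q * Moore δ g) where

  open import Data.Empty using (⊥-elim)
  open import Data.Nat.Properties
    using (≤-trans; ≤-reflexive; ≤-<-trans; <⇒≤; m≤m+n; m≤n+m; n≤1+n; +-comm; +-suc; +-identityʳ;
           +-∸-assoc; ∸-+-assoc; m∸n+n≡m; m+[n∸m]≡n; m+n≤o⇒m≤o∸n)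
  open import Data.Nat.Tactic.RingSolver using (solve-∀)
  open import Data.Product using (∃; _,_; proj₁; proj₂)
  open import Data.Sum using (inj₁; inj₂)
  open import Function.Base using (_∘_)
  open import Function.Bundles using (mk⇔)
  open import Relation.Binary.PropositionalEquality as ≡ using (cong; subst)
  open import Relation.Nullary.Decidable using (_⊎-dec_)

  open Modular q
  open Walks G
  open CycleIndex G C iso
  open MooreBound G δ min-degree girth

  k : ℕ
  k = kOf g

  private
    2k<q : k + k < q
    2k<q = ≤-<-trans (≤-trans (m≤m+n (k + k) _) (≤-reflexive (six k))) q-large
      where
      six : ∀ k → k + k + (k + k + (k + k) + 3) ≡ 6 * k + 3
      six = solve-∀

    k≤q : k ≤ q
    k≤q = ≤-trans (m≤m+n k k) (<⇒≤ 2k<q)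

    q∸k-split : q ∸ k ≡ (q ∸ (k + k)) + k
    q∸k-split = ≡.sym (≡.trans (cong (_+ k) (≡.sym (∸-+-assoc q k k)))
                               (m∸n+n≡m (m+n≤o⇒m≤o∸n k (<⇒≤ 2k<q))))

  -- In the claim, j = I + q ∸ k + t encodes i − k + t.
  centre+k : ∀ I t → I + q ∸ k + t + k ≡ₘ I + t
  centre+k I t = ≡.trans (≡⇒≡ₘ (begin
    I + q ∸ k + t + k         ≡⟨ cong (λ z → z + t + k) (+-∸-assoc I k≤q) ⟩
    I + (q ∸ k) + t + k       ≡⟨ regroup I (q ∸ k) t k ⟩
    I + t + ((q ∸ k) + k)     ≡⟨ cong (I + t +_) (m∸n+n≡m k≤q) ⟩
    I + t + q                 ∎)) (+q-≡ₘ (I + t))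
    where
    open ≡.≡-Reasoning
    regroup : ∀ a b c d → a + b + c + d ≡ a + c + (b + d)
    regroup = solve-∀

  centre∸k : ∀ I t → I + q ∸ k + t + q ∸ k ≡ₘ I + t + (q ∸ (k + k))
  centre∸k I t = ≡.trans (≡⇒≡ₘ (begin
    I + q ∸ k + t + q ∸ k                      ≡⟨ +-∸-assoc (I + q ∸ k + t) k≤q ⟩
    I + q ∸ k + t + (q ∸ k)                    ≡⟨ cong (λ z → z + t + (q ∸ k)) (+-∸-assoc I k≤q) ⟩
    I + (q ∸ k) + t + (q ∸ k)                  ≡⟨ cong (λ z → I + z + t + (q ∸ k)) q∸k-split ⟩
    I + ((q ∸ (k + k)) + k) + t + (q ∸ k)      ≡⟨ regroup I (q ∸ (k + k)) k t (q ∸ k) ⟩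
    I + t + (q ∸ (k + k)) + (k + (q ∸ k))      ≡⟨ cong (I + t + (q ∸ (k + k)) +_) (m+[n∸m]≡n k≤q) ⟩
    I + t + (q ∸ (k + k)) + q                  ∎)) (+q-≡ₘ (I + t + (q ∸ (k + k))))
    where
    open ≡.≡-Reasoning
    regroup : ∀ a b c d e → a + (b + c) + d + e ≡ a + d + b + (c + e)
    regroup = solve-∀

  module OddGirth (odd : g % 2 ≡ 1) where

    private
      g≡ : g ≡ suc (k + k)
      g≡ = odd⇒g≡1+2k g odd

      P : ℕ → Fin n → Set
      P x v = Ball G k (at C x) v

      P? : ∀ x → Decidable (P x)
      P? x = ball? k (at C x)

      P-resp : ∀ {x y v} → x ≡ₘ y → P x v → P y v
      P-resp x≡y = subst (λ u → Ball G k u _) (at-≡ₘ x≡y)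

      P-near : ∀ {x y v} → P x v → P y v → Near (k + k) x y
      P-near px py = ball⇒Near (ball-trans px (ball-sym py))

      lower : ∀ (a : Fin q) → Moore δ g ≤ count (P? (toℕ a))
      lower a = subst (_≤ count (P? (toℕ a))) (≡.sym (Moore-odd δ g odd))
                  (moore-bound-vertex (at C (toℕ a)) {k} (≤-reflexive (≡.sym g≡)))

      6k<q : (k + k) + (k + k) + (k + k) < q
      6k<q = ≤-<-trans (≤-trans (≤-reflexive (six k)) (m≤m+n (6 * k) 3)) q-large
        where
        six : ∀ k → (k + k) + (k + k) + (k + k) ≡ 6 * k
        six = solve-∀

      balance′ : suc (k + k) * n ≡ q * Moore δ g
      balance′ = subst (λ h → h * n ≡ q * Moore δ g) g≡ balance

    open DoubleCounting 6k<q P? P-resp P-near lower balance′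

    ball⇔ : ∀ I v → Ball G k (at C I) v ⇔ ∃ λ t → t ≤ 2 * k × InL G q k C (I + q ∸ k + t) v
    ball⇔ I v = mk⇔ (to ∘ arc-around) from
      where
      open ArcAt v
      open Saturated (arcs-saturated v)
      2k≡ : 2 * k ≡ k + k
      2k≡ = cong (k +_) (+-identityʳ k)
      to : (∃ λ t → t ≤ k + k × P (I + t) v × P (I + t + (q ∸ (k + k))) v) →
           ∃ λ t → t ≤ 2 * k × InL G q k C (I + q ∸ k + t) v
      to (t , t≤2k , s-end , s-start) =
        t , ≤-trans t≤2k (≤-reflexive (≡.sym 2k≡)) ,
        P-resp {I + t + (q ∸ (k + k))} (≡.sym (centre∸k I t)) s-start ,
        P-resp {I + t} (≡.sym (centre+k I t)) s-end
      from : (∃ λ t → t ≤ 2 * k × InL G q k C (I + q ∸ k + t) v) → Ball G k (at C I) v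
      from (t , t≤2k , b-start , b-end) =
        P-resp {I + t + (q ∸ t)} {I} (+-∸-≡ₘ I (≤-trans t≤2k′ (<⇒≤ 2k<q)))
          (arc-filled {I + t} (P-resp {I + q ∸ k + t + k} (centre+k I t) b-end)
                              (P-resp {I + q ∸ k + t + q ∸ k} (centre∸k I t) b-start) t≤2k′)
        where t≤2k′ = ≤-trans t≤2k (≤-reflexive 2k≡)

  module EvenGirth (even : g % 2 ≡ 0) (3≤g : 3 ≤ g) where

    private
      d : ℕ
      d = suc (k + k)

      g≡ : g ≡ suc d
      g≡ = even⇒g≡2+2k g even 3≤g

      P : ℕ → Fin n → Set
      P x v = EdgeBall G k (at C x) (at C (suc x)) v

      P? : ∀ x → Decidable (P x)
      P? x v = ball? k (at C x) v ⊎-dec ball? k (at C (suc x)) v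

      P-resp : ∀ {x y v} → x ≡ₘ y → P x v → P y v
      P-resp x≡y (inj₁ b) = inj₁ (subst (λ u → Ball G k u _) (at-≡ₘ x≡y) b)
      P-resp x≡y (inj₂ b) = inj₂ (subst (λ u → Ball G k u _) (at-≡ₘ (+-congˡ-≡ₘ 1 x≡y)) b)

      P-near : ∀ {x y v} → P x v → P y v → Near d x y
      P-near     (inj₁ bx) (inj₁ by) = ball⇒Near (ball-mono (n≤1+n _) (ball-trans bx (ball-sym by)))
      P-near {y = y} (inj₁ bx) (inj₂ by) =
        Near-sym (ball⇒Near (ball-step (at-adjacent y) (ball-trans by (ball-sym bx))))
      P-near {x} (inj₂ bx) (inj₁ by) = ball⇒Near (ball-step (at-adjacent x) (ball-trans bx (ball-sym by)))
      P-near     (inj₂ bx) (inj₂ by) =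
        Near-suc⁻¹ (ball⇒Near (ball-mono (n≤1+n _) (ball-trans bx (ball-sym by))))

      lower : ∀ (a : Fin q) → Moore δ g ≤ count (P? (toℕ a))
      lower a = subst (_≤ count (P? (toℕ a))) (≡.sym (Moore-even δ g even))
                  (moore-bound-edge {k = k} (at-adjacent (toℕ a)) (≤-reflexive (≡.sym g≡)))

      3d<q : d + d + d < q
      3d<q = ≤-<-trans (≤-reflexive (three k)) q-large
        where
        three : ∀ k → suc (k + k) + suc (k + k) + suc (k + k) ≡ 6 * k + 3
        three = solve-∀

      2d+1<q : d + suc d < q
      2d+1<q = ≤-<-trans (≤-trans (m≤m+n (d + suc d) _) (≤-reflexive (four k))) q-large
        where
        four : ∀ k → suc (k + k) + suc (suc (k + k)) + (k + k) ≡ 6 * k + 3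
        four = solve-∀

      suc-∸ : ∀ {m} → suc m ≤ q → suc (q ∸ suc m) ≡ q ∸ m
      suc-∸ sm≤q = ≡.sym (+-∸-assoc 1 sm≤q)

      1+d≤q : suc d ≤ q
      1+d≤q = ≤-trans (m≤n+m (suc d) d) (<⇒≤ 2d+1<q)

      d≤q : d ≤ q
      d≤q = ≤-trans (n≤1+n d) 1+d≤q

      start≡ : ∀ I t → I + q ∸ k + t + q ∸ k ≡ₘ suc (I + t + (q ∸ d))
      start≡ I t = ≡.trans (centre∸k I t)
                     (≡⇒≡ₘ (≡.trans (cong (I + t +_) (≡.sym (suc-∸ d≤q))) (+-suc (I + t) (q ∸ d))))

      balance′ : suc d * n ≡ q * Moore δ g
      balance′ = subst (λ h → h * n ≡ q * Moore δ g) g≡ balance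

    open DoubleCounting 3d<q P? P-resp P-near lower balance′

    edge-ball⇔ : ∀ I v → EdgeBall G k (at C I) (at C (suc I)) v ⇔
                         ∃ λ t → t ≤ 2 * k + 1 × InL G q k C (I + q ∸ k + t) v
    edge-ball⇔ I v = mk⇔ (to ∘ arc-around) from
      where
      open ArcAt v
      open Saturated (arcs-saturated v)
      2k+1≡ : 2 * k + 1 ≡ d
      2k+1≡ = ≡.trans (+-comm (2 * k) 1) (cong (λ m → suc (k + m)) (+-identityʳ k))
      to : (∃ λ t → t ≤ d × P (I + t) v × P (I + t + (q ∸ d)) v) →
           ∃ λ t → t ≤ 2 * k + 1 × InL G q k C (I + q ∸ k + t) v
      to (t , t≤d , s-end , s-start) =
        t , ≤-trans t≤d (≤-reflexive (≡.sym 2k+1≡)) , start-ball s-start , end-ball s-end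
        where
        e = I + t
        no-next = proj₁ (arc-isolated 2d+1<q s-end s-start)
        no-prev = proj₂ (arc-isolated 2d+1<q s-end s-start)
        end-ball : P e v → Ball G k (at C (I + q ∸ k + t + k)) v
        end-ball (inj₁ b) = subst (λ u → Ball G k u v) (at-≡ₘ (≡.sym (centre+k I t))) b
        end-ball (inj₂ b) = ⊥-elim (no-next (inj₁ b))
        start-ball : P (e + (q ∸ d)) v → Ball G k (at C (I + q ∸ k + t + q ∸ k)) v
        start-ball (inj₁ b) = ⊥-elim (no-prev (inj₂ (subst (λ u → Ball G k (at C u) v)
                                                        (≡.sym (≡.trans (≡.sym (+-suc e (q ∸ suc d)))
                                                                        (cong (e +_) (suc-∸ 1+d≤q))))
                                                        b)))
        start-ball (inj₂ b) = subst (λ u → Ball G k u v) (at-≡ₘ (≡.sym (start≡ I t))) b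
      from : (∃ λ t → t ≤ 2 * k + 1 × InL G q k C (I + q ∸ k + t) v) → EdgeBall G k (at C I) (at C (suc I)) v
      from (t , t≤ , b-start , b-end) =
        P-resp (+-∸-≡ₘ I (≤-trans t≤d d≤q))
          (arc-filled (inj₁ (subst (λ u → Ball G k u v) (at-≡ₘ (centre+k I t)) b-end))
                    (inj₂ (subst (λ u → Ball G k u v) (at-≡ₘ (start≡ I t)) b-start)) t≤d)
        where t≤d = ≤-trans t≤ (≤-reflexive 2k+1≡)


lemma17 : ∀ {n} (G : Graph n) (g δ q : ℕ) → Equatorial G g δ q
    → (C : Fin q → Fin n) → IsIsometricCycle G q C → {{_ : NonZero q}}
    → ∀ (i : Fin q) (v : Fin n)
    → (g % 2 ≡ 1 → (Ball G (kOf g) (at C (toℕ i)) v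
         ⇔ ∃ λ t → t ≤ 2 * kOf g × InL G q (kOf g) C (toℕ i + q ∸ kOf g + t) v))
    × (g % 2 ≡ 0 → (EdgeBall G (kOf g) (at C (toℕ i)) (at C (suc (toℕ i))) v
         ⇔ ∃ λ t → t ≤ 2 * kOf g + 1 × InL G q (kOf g) C (toℕ i + q ∸ kOf g + t) v))
lemma17 G g δ q (_ , 3≤g , (_ , girth) , (min-degree , _) , _ , q-large , balance) C iso i v =
  (λ odd → OddGirth.ball⇔ odd (toℕ i) v) , (λ even → EvenGirth.edge-ball⇔ even 3≤g (toℕ i) v)
  where open EquatorialCycle G C iso girth min-degree q-large balance
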